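{- For every $n\ge1$, writing $\mathcal{A}^{(1)}_m$ for the set of $1$-almost-increasing permutations in $S_m$, $$\mathcal{A}^{(1)}_{n+1}=\rho_{1,1}(\mathcal{A}^{(1)}_n)\cup\rho_{1,2}(\mathcal{A}^{(1)}_n)\cup\rho_{2,1}(\mathcal{A}^{(1)}_n)\cup\rho_{2,2}(\mathcal{A}^{(1)}_n).$$
   Context: A permutation $\pi\in S_m$ is $1$-almost-increasing if it avoids each of the patterns $4321, 4312, 3421, 3412$ (no subsequence of its one-line form has the same relative order as one of them). For $\pi\in S_m$ and $1\le i,j\le m+1$, $\rho_{i,j}(\pi)\in S_{m+1}$ is obtained by increasing by $1$ every entry of $\pi$ that is $\ge i$ and then inserting the value $i$ so that it occupies position $j$. -}

module Defs where

open import Data.Nat using (ℕ; zero; suc; _<_; _≤ᵇ_)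
open import Data.Bool using (if_then_else_)
open import Data.List using (List; []; _∷_; map; take; drop; _++_; upTo)
open import Data.List.Relation.Binary.Sublist.Propositional using (_⊆_)
open import Data.List.Relation.Binary.Permutation.Propositional using (_↭_)
open import Data.List.Relation.Binary.Pointwise using (Pointwise)
open import Data.Product using (Σ; _×_)
open import Data.Unit using (⊤)
open import Data.Empty using (⊥)
open import Function.Bundles using (_⇔_)
open import Relation.Nullary using (¬_)

-- Permutations in one-line form: lists of naturals.
-- The set S_m: lists that are a rearrangement of [1, 2, ..., m].
oneToM : ℕ → List ℕ
oneToM m = map suc (upTo m)

IsPerm : ℕ → List ℕ → Set
IsPerm m w = w ↭ oneToM m

SameOrder : List ℕ → List ℕ → Set
SameOrder [] [] = ⊤
SameOrder (x ∷ xs) (y ∷ ys) =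
  Pointwise (λ x′ y′ → (x < x′ ⇔ y < y′) × (x′ < x ⇔ y′ < y)) xs ys × SameOrder xs ys
SameOrder [] (_ ∷ _) = ⊥
SameOrder (_ ∷ _) [] = ⊥

Contains : List ℕ → List ℕ → Set
Contains p w = Σ (List ℕ) λ s → (s ⊆ w) × SameOrder s p

Avoids : List ℕ → List ℕ → Set
Avoids p w = ¬ Contains p w

OneAlmostIncreasing : List ℕ → Set
OneAlmostIncreasing w =
  Avoids (4 ∷ 3 ∷ 2 ∷ 1 ∷ []) w × Avoids (4 ∷ 3 ∷ 1 ∷ 2 ∷ []) w ×
  Avoids (3 ∷ 4 ∷ 2 ∷ 1 ∷ []) w × Avoids (3 ∷ 4 ∷ 1 ∷ 2 ∷ []) w

-- ρ_{i,j}: increase every entry ≥ i by 1, then insert value i at position j (1-indexed).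
ρ : ℕ → ℕ → List ℕ → List ℕ
ρ i j w = take (j Data.Nat.∸ 1) w′ ++ (i ∷ drop (j Data.Nat.∸ 1) w′)
  where
  w′ : List ℕ
  w′ = map (λ x → if i ≤ᵇ x then suc x else x) w

-- Relabelling by an order embedding and passing to a subsequence both preserve pattern
-- avoidance, and ρ_{i,j}(u) is the relabelling shift_i(u) with the value i inserted. For
-- i, j ≤ 2 the inserted value sits in one of the first two places, where each of the four
-- patterns has an entry lying above two distinct entries; as these are ≥ 1, the inserted
-- value would have to be ≥ 3, so no new occurrence arises. Conversely, if the first two
-- entries a, b of a permutation w were both ≥ 3, then a b 1 2 or a b 2 1 would be an
-- occurrence of one of the four patterns; so w has i ∈ {1, 2} at position j ≤ 2,
-- and deleting it and undoing the shift gives the required u.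
module Submission where

open import Defs
open import Data.Nat using (ℕ; zero; suc; pred; _≤_; _<_; _∸_; _≤ᵇ_; _<ᵇ_; z≤n; s≤s)
open import Data.Nat.Properties
  using (_≟_; _≤?_; <-cmp; <-asym; <-irrefl; ≤-refl; ≤-trans; <-≤-trans; <⇒≤; <⇒≱; ≰⇒>; n≤1+n;
         1+n≰n; ∸-monoˡ-≤; suc-injective; <ᵇ⇒<; ≤ᵇ-reflects-≤; <ᵇ-reflects-<)
open import Data.Bool using (T; true; false; if_then_else_)
open import Data.List using (List; []; _∷_; map; take; drop; _++_; upTo)
open import Data.List.Properties using (map-applyUpTo; map-∘; map-id-local; map-cong-local; take++drop≡id)
open import Data.List.Relation.Binary.Sublist.Propositional using (_⊆_; []; _∷_; _∷ʳ_; ⊆-refl; ⊆-trans; minimum; from∈)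
open import Data.List.Relation.Binary.Sublist.Propositional.Properties using (All-resp-⊆) renaming (map⁺ to ⊆-map⁺)
open import Data.List.Relation.Binary.Permutation.Propositional
  using (_↭_; ↭-prep; ↭-swap; ↭-refl; ↭-reflexive; ↭-sym; ↭-trans; ↭⇒↭ₛ; module PermutationReasoning)
open import Data.List.Relation.Binary.Permutation.Propositional.Properties
  using (All-resp-↭; ∈-resp-↭; ↭-length; drop-∷) renaming (map⁺ to ↭-map⁺; shift to ↭-shift)
import Data.List.Relation.Binary.Permutation.Setoid.Properties as ↭ₛ
open import Data.List.Relation.Binary.Pointwise using (Pointwise; []; _∷_)
open import Data.List.Relation.Unary.All using (All; []; _∷_; universal) renaming (map to All-map; head to All-head; tail to All-tail)
open import Data.List.Relation.Unary.All.Properties using () renaming (map⁺ to All-map⁺)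
open import Data.List.Relation.Unary.Any using (here; there) renaming (tail to Any-tail)
open import Data.List.Membership.Propositional using (_∈_)
open import Data.List.Relation.Unary.Unique.Propositional using (Unique)
open import Data.List.Relation.Unary.Unique.Propositional.Properties using (upTo⁺) renaming (map⁺ to Unique-map⁺)
open import Data.List.Relation.Unary.AllPairs using () renaming (head to AllPairs-head)
open import Data.Product using (Σ; _×_; _,_; proj₁; proj₂; uncurry) renaming (map₂ to Σ-map₂)
open import Data.Sum using (_⊎_; inj₁; inj₂) renaming (map to ⊎-map)
open import Data.Unit using (tt)
open import Data.Empty using (⊥-elim)
open import Function using (_∘_; id)
open import Function.Bundles using (_⇔_; mk⇔; module Equivalence)
import Function.Properties.Equivalence as ⇔
open import Relation.Nullary using (¬_; yes; no)
open import Relation.Nullary.Reflects using (ofʸ; ofⁿ)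
open import Relation.Binary.Definitions using (tri<; tri≈; tri>)
open import Relation.Binary.PropositionalEquality
  using (_≡_; _≢_; refl; sym; trans; cong; cong₂; subst; setoid; module ≡-Reasoning)

open Equivalence using (from)

private
  lit : ∀ {m n} {_ : T (m <ᵇ n)} → m < n
  lit {m} {n} {m<ᵇn} = <ᵇ⇒< m n m<ᵇn

IsOrderEmbedding : (ℕ → ℕ) → Set
IsOrderEmbedding g = ∀ x y → x < y ⇔ g x < g y

strictlyMonotone⇒orderEmbedding : ∀ {g} → (∀ {x y} → x < y → g x < g y) → IsOrderEmbedding g
strictlyMonotone⇒orderEmbedding {g} mono x y = mk⇔ mono reflect
  where
  reflect : g x < g y → x < y
  reflect gx<gy with <-cmp x y
  ... | tri< x<y _ _ = x<y
  ... | tri≈ _ refl _ = ⊥-elim (<-irrefl refl gx<gy)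
  ... | tri> _ _ y<x = ⊥-elim (<-asym gx<gy (mono y<x))

SameComparison : ℕ → ℕ → ℕ → ℕ → Set
SameComparison x x′ y y′ = (x < x′ ⇔ y < y′) × (x′ < x ⇔ y′ < y)

sameComparison-< : ∀ {x x′ y y′} → x < x′ → y < y′ → SameComparison x x′ y y′
sameComparison-< x<x′ y<y′ =
  mk⇔ (λ _ → y<y′) (λ _ → x<x′) , mk⇔ (⊥-elim ∘ <-asym x<x′) (⊥-elim ∘ <-asym y<y′)

sameComparison-> : ∀ {x x′ y y′} → x′ < x → y′ < y → SameComparison x x′ y y′
sameComparison-> x′<x y′<y =
  mk⇔ (⊥-elim ∘ <-asym x′<x) (⊥-elim ∘ <-asym y′<y) , mk⇔ (λ _ → y′<y) (λ _ → x′<x)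

module _ {g : ℕ → ℕ} (g-emb : IsOrderEmbedding g) where

  private
    comparison⁺ : ∀ {x x′ y y′} → SameComparison x x′ y y′ → SameComparison (g x) (g x′) y y′
    comparison⁺ {x} {x′} (lt , gt) = ⇔.trans (⇔.sym (g-emb x x′)) lt , ⇔.trans (⇔.sym (g-emb x′ x)) gt

    comparison⁻ : ∀ {x x′ y y′} → SameComparison (g x) (g x′) y y′ → SameComparison x x′ y y′
    comparison⁻ {x} {x′} (lt , gt) = ⇔.trans (g-emb x x′) lt , ⇔.trans (g-emb x′ x) gt

    pointwise⁺ : ∀ {x y xs ys} → Pointwise (λ x′ y′ → SameComparison x x′ y y′) xs ys →
                 Pointwise (λ x′ y′ → SameComparison (g x) x′ y y′) (map g xs) ys
    pointwise⁺ [] = []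
    pointwise⁺ (c ∷ cs) = comparison⁺ c ∷ pointwise⁺ cs

    pointwise⁻ : ∀ {x y} xs {ys} → Pointwise (λ x′ y′ → SameComparison (g x) x′ y y′) (map g xs) ys →
                 Pointwise (λ x′ y′ → SameComparison x x′ y y′) xs ys
    pointwise⁻ [] [] = []
    pointwise⁻ (_ ∷ xs) (c ∷ cs) = comparison⁻ c ∷ pointwise⁻ xs cs

  sameOrder-map⁺ : ∀ s {p} → SameOrder s p → SameOrder (map g s) p
  sameOrder-map⁺ [] {[]} tt = tt
  sameOrder-map⁺ (_ ∷ s) {_ ∷ _} (cs , so) = pointwise⁺ cs , sameOrder-map⁺ s so

  sameOrder-map⁻ : ∀ s {p} → SameOrder (map g s) p → SameOrder s p
  sameOrder-map⁻ [] {[]} tt = tt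
  sameOrder-map⁻ (_ ∷ s) {_ ∷ _} (cs , so) = pointwise⁻ s cs , sameOrder-map⁻ s so

⊆-map⁻ : ∀ {A B : Set} {f : A → B} u {s} → s ⊆ map f u → Σ (List A) λ s₀ → s₀ ⊆ u × s ≡ map f s₀
⊆-map⁻ [] [] = [] , [] , refl
⊆-map⁻ (x ∷ u) (_ ∷ʳ s⊆u) with ⊆-map⁻ u s⊆u
... | s₀ , s₀⊆u , refl = s₀ , x ∷ʳ s₀⊆u , refl
⊆-map⁻ (x ∷ u) (refl ∷ s⊆u) with ⊆-map⁻ u s⊆u
... | s₀ , s₀⊆u , refl = x ∷ s₀ , refl ∷ s₀⊆u , refl

contains-⊆ : ∀ {p u w} → u ⊆ w → Contains p u → Contains p w
contains-⊆ u⊆w (s , s⊆u , so) = s , ⊆-trans s⊆u u⊆w , so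

contains-map⁺ : ∀ {g p u} → IsOrderEmbedding g → Contains p u → Contains p (map g u)
contains-map⁺ g-emb (s , s⊆u , so) = map _ s , ⊆-map⁺ _ s⊆u , sameOrder-map⁺ g-emb s so

contains-map⁻ : ∀ {g p} u → IsOrderEmbedding g → Contains p (map g u) → Contains p u
contains-map⁻ u g-emb (s , s⊆gu , so) with ⊆-map⁻ u s⊆gu
... | s₀ , s₀⊆u , refl = s₀ , s₀⊆u , sameOrder-map⁻ g-emb s₀ so

oai-reflect : ∀ {u w} → (∀ {p} → Contains p u → Contains p w) →
              OneAlmostIncreasing w → OneAlmostIncreasing u
oai-reflect u→w (a₁ , a₂ , a₃ , a₄) = a₁ ∘ u→w , a₂ ∘ u→w , a₃ ∘ u→w , a₄ ∘ u→w

oai-⊆ : ∀ {u w} → u ⊆ w → OneAlmostIncreasing w → OneAlmostIncreasing u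
oai-⊆ u⊆w = oai-reflect (contains-⊆ u⊆w)

oai-map⁺ : ∀ {g u} → IsOrderEmbedding g → OneAlmostIncreasing u → OneAlmostIncreasing (map g u)
oai-map⁺ {u = u} g-emb = oai-reflect (contains-map⁻ u g-emb)

oai-map⁻ : ∀ {g u} → IsOrderEmbedding g → OneAlmostIncreasing (map g u) → OneAlmostIncreasing u
oai-map⁻ g-emb = oai-reflect (contains-map⁺ g-emb)

-- Patterns with their two largest entries first

Dominates : ℕ → ℕ → ℕ → ℕ → Set
Dominates x y e g = (e < x × g < x) × (e < y × g < y)

dominates-swap : ∀ {x y e g} → Dominates x y e g → Dominates x y g e
dominates-swap ((e<x , g<x) , (e<y , g<y)) = (g<x , e<x) , (g<y , e<y)

TopTwoFirst : ℕ → ℕ → ℕ → ℕ → Set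
TopTwoFirst c d e g = Dominates c d e g × (e < g ⊎ g < e)

sameOrder-topTwoFirst : ∀ {x y e g c d e′ g′} → SameComparison x y c d → SameComparison e g e′ g′ →
  Dominates x y e g → Dominates c d e′ g′ → SameOrder (x ∷ y ∷ e ∷ g ∷ []) (c ∷ d ∷ e′ ∷ g′ ∷ [])
sameOrder-topTwoFirst xy eg ((e<x , g<x) , (e<y , g<y)) ((e′<c , g′<c) , (e′<d , g′<d)) =
  (xy ∷ sameComparison-> e<x e′<c ∷ sameComparison-> g<x g′<c ∷ []) ,
  (sameComparison-> e<y e′<d ∷ sameComparison-> g<y g′<d ∷ []) , (eg ∷ []) , [] , tt

above-two-positives : ∀ {x y z} → 1 ≤ y → 1 ≤ z → y < x → z < x → y < z ⊎ z < y → 3 ≤ x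
above-two-positives 1≤y _ _ z<x (inj₁ y<z) = ≤-trans (s≤s (≤-trans (s≤s 1≤y) y<z)) z<x
above-two-positives _ 1≤z y<x _ (inj₂ z<y) = ≤-trans (s≤s (≤-trans (s≤s 1≤z) z<y)) y<x

sameOrder-above-two : ∀ {x s d e g} → SameOrder (x ∷ s) (d ∷ e ∷ g ∷ []) → All (1 ≤_) s →
                      e < d → g < d → e < g ⊎ g < e → 3 ≤ x
sameOrder-above-two ((cy ∷ cz ∷ []) , (cyz ∷ []) , _) (1≤y ∷ 1≤z ∷ []) e<d g<d e⋚g =
  above-two-positives 1≤y 1≤z (from (proj₂ cy) e<d) (from (proj₂ cz) g<d)
                      (⊎-map (from (proj₁ cyz)) (from (proj₂ cyz)) e⋚g)

sameOrder-above-lastTwo : ∀ {x s c d e g} → SameOrder (x ∷ s) (c ∷ d ∷ e ∷ g ∷ []) → All (1 ≤_) s →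
                          e < c → g < c → e < g ⊎ g < e → 3 ≤ x
sameOrder-above-lastTwo ((_ ∷ cs) , _ , so) (_ ∷ pos) = sameOrder-above-two (cs , so) pos

insertAt : ∀ {A : Set} → ℕ → A → List A → List A
insertAt k x v = take k v ++ x ∷ drop k v

insertAt-↭ : ∀ {A : Set} k (x : A) v → insertAt k x v ↭ x ∷ v
insertAt-↭ k x v = ↭-trans (↭-shift x (take k v) (drop k v)) (↭-prep x (↭-reflexive (take++drop≡id k v)))

⊆-insertAt : ∀ {A : Set} k (x : A) v → v ⊆ insertAt k x v
⊆-insertAt zero x v = x ∷ʳ ⊆-refl
⊆-insertAt (suc k) x [] = minimum _
⊆-insertAt (suc k) x (y ∷ v) = refl ∷ ⊆-insertAt k x v

module _ {c d e g : ℕ} (top : TopTwoFirst c d e g) where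

  private
    P : List ℕ
    P = c ∷ d ∷ e ∷ g ∷ []

  avoids-∷ : ∀ {i v} → i ≤ 2 → All (1 ≤_) v → Avoids P v → Avoids P (i ∷ v)
  avoids-∷ _ _ avoid (s , (_ ∷ʳ s⊆v) , so) = avoid (s , s⊆v , so)
  avoids-∷ i≤2 pos _ (_ , (refl ∷ s⊆v) , so) =
    <⇒≱ (sameOrder-above-lastTwo so (All-resp-⊆ s⊆v pos) e<c g<c (proj₂ top)) i≤2
    where
    e<c : e < c
    e<c = proj₁ (proj₁ (proj₁ top))
    g<c : g < c
    g<c = proj₂ (proj₁ (proj₁ top))

  avoids-insertSecond : ∀ {i a r} → i ≤ 2 → All (1 ≤_) r → Avoids P (a ∷ r) → Avoids P (a ∷ i ∷ r)
  avoids-insertSecond _ _ avoid (s , (_ ∷ʳ _ ∷ʳ s⊆r) , so) = avoid (s , _ ∷ʳ s⊆r , so)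
  avoids-insertSecond i≤2 pos avoid (s , (_ ∷ʳ refl ∷ s⊆r) , so) =
    avoids-∷ i≤2 pos (avoid ∘ contains-⊆ (_ ∷ʳ ⊆-refl)) (s , refl ∷ s⊆r , so)
  avoids-insertSecond _ _ avoid (s , (refl ∷ _ ∷ʳ s⊆r) , so) = avoid (s , refl ∷ s⊆r , so)
  avoids-insertSecond i≤2 pos _ (_ , (refl ∷ refl ∷ s⊆r) , (_ , so)) =
    <⇒≱ (sameOrder-above-two so (All-resp-⊆ s⊆r pos) e<d g<d (proj₂ top)) i≤2
    where
    e<d : e < d
    e<d = proj₁ (proj₂ (proj₁ top))
    g<d : g < d
    g<d = proj₂ (proj₂ (proj₁ top))

  avoids-insertAt : ∀ {k i v} → k ≤ 1 → i ≤ 2 → All (1 ≤_) v → Avoids P v → Avoids P (insertAt k i v)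
  avoids-insertAt {zero} _ = avoids-∷
  avoids-insertAt {suc zero} {v = []} _ = avoids-∷
  avoids-insertAt {suc zero} {v = _ ∷ _} _ i≤2 (_ ∷ pos) = avoids-insertSecond i≤2 pos
  avoids-insertAt {suc (suc _)} (s≤s ())

oai-insertAt : ∀ {k i v} → k ≤ 1 → i ≤ 2 → All (1 ≤_) v →
               OneAlmostIncreasing v → OneAlmostIncreasing (insertAt k i v)
oai-insertAt k≤1 i≤2 pos (a₁ , a₂ , a₃ , a₄) =
  avoids-insertAt (((lit , lit) , (lit , lit)) , inj₂ lit) k≤1 i≤2 pos a₁ ,
  avoids-insertAt (((lit , lit) , (lit , lit)) , inj₁ lit) k≤1 i≤2 pos a₂ ,
  avoids-insertAt (((lit , lit) , (lit , lit)) , inj₂ lit) k≤1 i≤2 pos a₃ ,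
  avoids-insertAt (((lit , lit) , (lit , lit)) , inj₁ lit) k≤1 i≤2 pos a₄

shift : ℕ → ℕ → ℕ
shift i x = if i ≤ᵇ x then suc x else x

unshift : ℕ → ℕ → ℕ
unshift i x = if i <ᵇ x then pred x else x

shift-≥ : ∀ {i x} → i ≤ x → shift i x ≡ suc x
shift-≥ {i} {x} i≤x with i ≤ᵇ x | ≤ᵇ-reflects-≤ i x
... | true | _ = refl
... | false | ofⁿ i≰x = ⊥-elim (i≰x i≤x)

shift-< : ∀ {i x} → x < i → shift i x ≡ x
shift-< {i} {x} x<i with i ≤ᵇ x | ≤ᵇ-reflects-≤ i x
... | false | _ = refl
... | true | ofʸ i≤x = ⊥-elim (<⇒≱ x<i i≤x)

unshift-> : ∀ {i x} → i < x → unshift i x ≡ pred x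
unshift-> {i} {x} i<x with i <ᵇ x | <ᵇ-reflects-< i x
... | true | _ = refl
... | false | ofⁿ i≮x = ⊥-elim (i≮x i<x)

unshift-≤ : ∀ {i x} → x ≤ i → unshift i x ≡ x
unshift-≤ {i} {x} x≤i with i <ᵇ x | <ᵇ-reflects-< i x
... | false | _ = refl
... | true | ofʸ i<x = ⊥-elim (<⇒≱ i<x x≤i)

≤-shift : ∀ i x → x ≤ shift i x
≤-shift i x with i ≤ᵇ x
... | true = n≤1+n x
... | false = ≤-refl

shift-suc : ∀ i y → shift (suc i) (suc y) ≡ suc (shift i y)
shift-suc zero y = refl
shift-suc (suc i) y with i <ᵇ y
... | true = refl
... | false = refl

shift-strictlyMonotone : ∀ i {x y} → x < y → shift i x < shift i y
shift-strictlyMonotone i {x} {y} x<y with i ≤? x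
... | yes i≤x rewrite shift-≥ i≤x | shift-≥ (≤-trans i≤x (<⇒≤ x<y)) = s≤s x<y
... | no i≰x rewrite shift-< (≰⇒> i≰x) = <-≤-trans x<y (≤-shift i y)

shift-isOrderEmbedding : ∀ i → IsOrderEmbedding (shift i)
shift-isOrderEmbedding i = strictlyMonotone⇒orderEmbedding (shift-strictlyMonotone i)

shift-≢ : ∀ i x → shift i x ≢ i
shift-≢ i x with i ≤? x
... | yes i≤x rewrite shift-≥ i≤x = λ 1+x≡i → 1+n≰n (subst (_≤ x) (sym 1+x≡i) i≤x)
... | no i≰x rewrite shift-< (≰⇒> i≰x) = λ x≡i → i≰x (subst (i ≤_) (sym x≡i) ≤-refl)

unshift-shift : ∀ i x → unshift i (shift i x) ≡ x
unshift-shift i x with i ≤? x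
... | yes i≤x rewrite shift-≥ i≤x = unshift-> (s≤s i≤x)
... | no i≰x rewrite shift-< (≰⇒> i≰x) = unshift-≤ (<⇒≤ (≰⇒> i≰x))

shift-unshift : ∀ {i x} → x ≢ i → shift i (unshift i x) ≡ x
shift-unshift {i} {x} x≢i with <-cmp i x
... | tri< (s≤s i≤y) _ _ rewrite unshift-> (s≤s i≤y) = shift-≥ i≤y
... | tri≈ _ i≡x _ = ⊥-elim (x≢i (sym i≡x))
... | tri> _ _ x<i rewrite unshift-≤ (<⇒≤ x<i) = shift-< x<i

oneToM-suc : ∀ n → oneToM (suc n) ≡ 1 ∷ map suc (oneToM n)
oneToM-suc n = cong (λ xs → 1 ∷ map suc xs) (sym (map-applyUpTo id suc n))

oneToM-positive : ∀ n → All (1 ≤_) (oneToM n)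
oneToM-positive n = All-map⁺ (universal (λ _ → s≤s z≤n) (upTo n))

isPerm-positive : ∀ {n w} → IsPerm n w → All (1 ≤_) w
isPerm-positive {n} w↭ = All-resp-↭ (↭-sym w↭) (oneToM-positive n)

isPerm-unique : ∀ {n w} → IsPerm n w → Unique w
isPerm-unique {n} w↭ =
  ↭ₛ.Unique-resp-↭ (setoid ℕ) (↭⇒↭ₛ (↭-sym w↭)) (Unique-map⁺ suc-injective (upTo⁺ n))

shift-oneToM : ∀ {i} n → 1 ≤ i → i ≤ suc n → i ∷ map (shift i) (oneToM n) ↭ oneToM (suc n)
shift-oneToM {suc zero} n _ _ = ↭-reflexive (begin
  1 ∷ map (shift 1) (oneToM n) ≡⟨ cong (1 ∷_) (map-cong-local (All-map shift-≥ (oneToM-positive n))) ⟩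
  1 ∷ map suc (oneToM n)       ≡⟨ sym (oneToM-suc n) ⟩
  oneToM (suc n)               ∎)
  where open ≡-Reasoning
shift-oneToM {suc (suc k)} zero _ (s≤s ())
shift-oneToM {suc (suc k)} (suc n) _ (s≤s k<1+n) = begin
  2+k ∷ map (shift 2+k) (oneToM (suc n))
    ≡⟨ cong (λ xs → 2+k ∷ map (shift 2+k) xs) (oneToM-suc n) ⟩
  2+k ∷ 1 ∷ map (shift 2+k) (map suc (oneToM n))
    ≡⟨ cong (λ xs → 2+k ∷ 1 ∷ xs) (map-shift-suc (oneToM n)) ⟩
  2+k ∷ 1 ∷ map suc (map (shift (suc k)) (oneToM n))
    ↭⟨ ↭-swap 2+k 1 ↭-refl ⟩
  1 ∷ map suc (suc k ∷ map (shift (suc k)) (oneToM n))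
    ↭⟨ ↭-prep 1 (↭-map⁺ suc (shift-oneToM n lit k<1+n)) ⟩
  1 ∷ map suc (oneToM (suc n))
    ≡⟨ sym (oneToM-suc (suc n)) ⟩
  oneToM (suc (suc n)) ∎
  where
  open PermutationReasoning
  2+k : ℕ
  2+k = suc (suc k)
  map-shift-suc : ∀ xs → map (shift 2+k) (map suc xs) ≡ map suc (map (shift (suc k)) xs)
  map-shift-suc [] = refl
  map-shift-suc (x ∷ xs) = cong₂ _∷_ (shift-suc (suc k) x) (map-shift-suc xs)

unshift-oneToM : ∀ {i n v} → 1 ≤ i → i ≤ suc n → i ∷ v ↭ oneToM (suc n) →
                 map (unshift i) v ↭ oneToM n × All (_≢ i) v
unshift-oneToM {i} {n} {v} 1≤i i≤1+n i∷v↭ =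
  ↭-trans (↭-map⁺ (unshift i) v↭) (↭-reflexive map-unshift-shift) ,
  All-resp-↭ (↭-sym v↭) (All-map⁺ (universal (shift-≢ i) (oneToM n)))
  where
  v↭ : v ↭ map (shift i) (oneToM n)
  v↭ = drop-∷ (↭-trans i∷v↭ (↭-sym (shift-oneToM n 1≤i i≤1+n)))
  map-unshift-shift : map (unshift i) (map (shift i) (oneToM n)) ≡ oneToM n
  map-unshift-shift = trans (sym (map-∘ (oneToM n))) (map-id-local (universal (unshift-shift i) (oneToM n)))

map-shift-unshift : ∀ {i v} → All (_≢ i) v → map (shift i) (map (unshift i) v) ≡ v
map-shift-unshift {v = v} v≢i = trans (sym (map-∘ v)) (map-id-local (All-map shift-unshift v≢i))

-- The operations ρ_{i,j}: ρ i j u unfolds to insertAt (j ∸ 1) i (map (shift i) u).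

ρ-isPerm : ∀ {i n} j {u} → 1 ≤ i → i ≤ suc n → IsPerm n u → IsPerm (suc n) (ρ i j u)
ρ-isPerm {i} {n} j {u} 1≤i i≤1+n u↭ = begin
  ρ i j u                      ↭⟨ insertAt-↭ (j ∸ 1) i (map (shift i) u) ⟩
  i ∷ map (shift i) u          ↭⟨ ↭-prep i (↭-map⁺ (shift i) u↭) ⟩
  i ∷ map (shift i) (oneToM n) ↭⟨ shift-oneToM n 1≤i i≤1+n ⟩
  oneToM (suc n)               ∎
  where open PermutationReasoning

ρ-oai : ∀ {i n} j {u} → i ≤ 2 → j ≤ 2 → IsPerm n u → OneAlmostIncreasing u →
        OneAlmostIncreasing (ρ i j u)
ρ-oai {i} j i≤2 j≤2 u↭ oai =
  oai-insertAt (∸-monoˡ-≤ 1 j≤2) i≤2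
    (All-map⁺ (All-map (λ 1≤x → ≤-trans 1≤x (≤-shift i _)) (isPerm-positive u↭)))
    (oai-map⁺ (shift-isOrderEmbedding i) oai)

ρ-preimage : ∀ {i n} j v → 1 ≤ i → i ≤ suc n → insertAt (j ∸ 1) i v ↭ oneToM (suc n) →
  OneAlmostIncreasing (insertAt (j ∸ 1) i v) →
  Σ (List ℕ) λ u → (IsPerm n u × OneAlmostIncreasing u) × insertAt (j ∸ 1) i v ≡ ρ i j u
ρ-preimage {i} {n} j v 1≤i i≤1+n w↭ oai =
  map (unshift i) v , (proj₁ deleted , oai-map⁻ (shift-isOrderEmbedding i) oai-shifted) ,
  cong (insertAt (j ∸ 1) i) (sym v≡)
  where
  deleted : map (unshift i) v ↭ oneToM n × All (_≢ i) v
  deleted = unshift-oneToM 1≤i i≤1+n (↭-trans (↭-sym (insertAt-↭ (j ∸ 1) i v)) w↭)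
  v≡ : map (shift i) (map (unshift i) v) ≡ v
  v≡ = map-shift-unshift (proj₂ deleted)
  oai-shifted : OneAlmostIncreasing (map (shift i) (map (unshift i) v))
  oai-shifted = subst OneAlmostIncreasing (sym v≡) (oai-⊆ (⊆-insertAt (j ∸ 1) i v) oai)

ρ-closed : ∀ {i m} j {u} → 1 ≤ i → i ≤ 2 → j ≤ 2 → IsPerm (suc m) u → OneAlmostIncreasing u →
           IsPerm (suc (suc m)) (ρ i j u) × OneAlmostIncreasing (ρ i j u)
ρ-closed j 1≤i i≤2 j≤2 u↭ oai =
  ρ-isPerm j 1≤i (≤-trans i≤2 lit) u↭ , ρ-oai j i≤2 j≤2 u↭ oai

pair-⊆ : ∀ {A : Set} {x y : A} {l} → x ∈ l → y ∈ l → x ≢ y → (x ∷ y ∷ []) ⊆ l ⊎ (y ∷ x ∷ []) ⊆ l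
pair-⊆ (here refl) (here refl) x≢y = ⊥-elim (x≢y refl)
pair-⊆ (here refl) (there y∈l) _ = inj₁ (refl ∷ from∈ y∈l)
pair-⊆ (there x∈l) (here refl) _ = inj₂ (refl ∷ from∈ x∈l)
pair-⊆ (there x∈l) (there y∈l) x≢y = ⊎-map (_ ∷ʳ_) (_ ∷ʳ_) (pair-⊆ x∈l y∈l x≢y)

above-1-2 : ∀ {x} → 1 ≤ x → x ≢ 1 → x ≢ 2 → 1 < x × 2 < x
above-1-2 {suc zero} _ x≢1 _ = ⊥-elim (x≢1 refl)
above-1-2 {suc (suc zero)} _ _ x≢2 = ⊥-elim (x≢2 refl)
above-1-2 {suc (suc (suc _))} _ _ _ = lit , lit

occurrence-topTwoFirst : ∀ {a b r e g c d e′ g′} → SameComparison a b c d → SameComparison e g e′ g′ →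
  Dominates a b e g → Dominates c d e′ g′ → (e ∷ g ∷ []) ⊆ r → Contains (c ∷ d ∷ e′ ∷ g′ ∷ []) (a ∷ b ∷ r)
occurrence-topTwoFirst ab eg dom dom′ eg⊆r = _ , refl ∷ refl ∷ eg⊆r , sameOrder-topTwoFirst ab eg dom dom′

¬oai-aboveOneTwo : ∀ {a b r} → a ≢ b → Dominates a b 1 2 → 1 ∈ r → 2 ∈ r →
                   ¬ OneAlmostIncreasing (a ∷ b ∷ r)
¬oai-aboveOneTwo {a} {b} a≢b dom 1∈r 2∈r (a₁ , a₂ , a₃ , a₄) with <-cmp a b | pair-⊆ 1∈r 2∈r (λ ())
... | tri< a<b _ _ | inj₁ 12⊆r = a₄ (occurrence-topTwoFirst
  (sameComparison-< a<b lit) (sameComparison-< lit lit) dom ((lit , lit) , (lit , lit)) 12⊆r)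
... | tri< a<b _ _ | inj₂ 21⊆r = a₃ (occurrence-topTwoFirst
  (sameComparison-< a<b lit) (sameComparison-> lit lit) (dominates-swap dom) ((lit , lit) , (lit , lit)) 21⊆r)
... | tri> _ _ b<a | inj₁ 12⊆r = a₂ (occurrence-topTwoFirst
  (sameComparison-> b<a lit) (sameComparison-< lit lit) dom ((lit , lit) , (lit , lit)) 12⊆r)
... | tri> _ _ b<a | inj₂ 21⊆r = a₁ (occurrence-topTwoFirst
  (sameComparison-> b<a lit) (sameComparison-> lit lit) (dominates-swap dom) ((lit , lit) , (lit , lit)) 21⊆r)
... | tri≈ _ a≡b _ | _ = a≢b a≡b

ρ-Decomposition : ℕ → List ℕ → Set
ρ-Decomposition n w = Σ (List ℕ) λ u → (IsPerm n u × OneAlmostIncreasing u) ×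
  (w ≡ ρ 1 1 u ⊎ w ≡ ρ 1 2 u ⊎ w ≡ ρ 2 1 u ⊎ w ≡ ρ 2 2 u)

decompose : ∀ m w → IsPerm (suc (suc m)) w → OneAlmostIncreasing w → ρ-Decomposition (suc m) w
decompose m [] w↭ _ with ↭-length w↭
... | ()
decompose m (_ ∷ []) w↭ _ with ↭-length w↭
... | ()
decompose m (a ∷ b ∷ r) w↭ oai with a ≟ 1 | a ≟ 2 | b ≟ 1 | b ≟ 2
... | yes refl | _ | _ | _ = Σ-map₂ (Σ-map₂ inj₁) (ρ-preimage 1 (b ∷ r) lit lit w↭ oai)
... | no _ | yes refl | _ | _ = Σ-map₂ (Σ-map₂ (inj₂ ∘ inj₂ ∘ inj₁)) (ρ-preimage 1 (b ∷ r) lit lit w↭ oai)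
... | no _ | no _ | yes refl | _ = Σ-map₂ (Σ-map₂ (inj₂ ∘ inj₁)) (ρ-preimage 2 (a ∷ r) lit lit w↭ oai)
... | no _ | no _ | no _ | yes refl = Σ-map₂ (Σ-map₂ (inj₂ ∘ inj₂ ∘ inj₂)) (ρ-preimage 2 (a ∷ r) lit lit w↭ oai)
... | no a≢1 | no a≢2 | no b≢1 | no b≢2 =
  ⊥-elim (¬oai-aboveOneTwo a≢b (above-1-2 1≤a a≢1 a≢2 , above-1-2 1≤b b≢1 b≢2)
                           (∈-rest a≢1 b≢1 (here refl)) (∈-rest a≢2 b≢2 (there (here refl))) oai)
  where
  1≤a : 1 ≤ a
  1≤a = All-head (isPerm-positive w↭)
  1≤b : 1 ≤ b
  1≤b = All-head (All-tail (isPerm-positive w↭))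
  a≢b : a ≢ b
  a≢b = All-head (AllPairs-head (isPerm-unique w↭))
  ∈-rest : ∀ {k} → a ≢ k → b ≢ k → k ∈ oneToM (suc (suc m)) → k ∈ r
  ∈-rest a≢k b≢k k∈ = Any-tail (b≢k ∘ sym) (Any-tail (a≢k ∘ sym) (∈-resp-↭ (↭-sym w↭) k∈))

compose : ∀ m w → ρ-Decomposition (suc m) w → IsPerm (suc (suc m)) w × OneAlmostIncreasing w
compose m _ (u , (u↭ , oai) , inj₁ refl) = ρ-closed 1 lit lit lit u↭ oai
compose m _ (u , (u↭ , oai) , inj₂ (inj₁ refl)) = ρ-closed 2 lit lit lit u↭ oai
compose m _ (u , (u↭ , oai) , inj₂ (inj₂ (inj₁ refl))) = ρ-closed 1 lit lit lit u↭ oai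
compose m _ (u , (u↭ , oai) , inj₂ (inj₂ (inj₂ refl))) = ρ-closed 2 lit lit lit u↭ oai

mainTheorem13 : (n : ℕ) → 1 ≤ n → (w : List ℕ) →
    (IsPerm (suc n) w × OneAlmostIncreasing w) ⇔
    (Σ (List ℕ) λ u → (IsPerm n u × OneAlmostIncreasing u) ×
      (w ≡ ρ 1 1 u ⊎ w ≡ ρ 1 2 u ⊎ w ≡ ρ 2 1 u ⊎ w ≡ ρ 2 2 u))
mainTheorem13 (suc m) (s≤s z≤n) w = mk⇔ (uncurry (decompose m w)) (compose m w)
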